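{- For any simple formula $G$ and any interpretations $I$ and $J$: if $I\models FT(G,I)^{I\setminus J}_\bot$ then $J\models FT(G,I)$.
   Context: Infinitary propositional formulas: atoms, arbitrary conjunctions $\mathcal H^\land$, disjunctions $\mathcal H^\lor$, implications; $\top=\emptyset^\land$, $\bot=\emptyset^\lor$, $\neg F=F\to\bot$; interpretations are sets of atoms with the usual satisfaction. FT-reduct: $FT(p,I)=p$ if $p\in I$, else $\bot$; $FT(\mathcal H^\land,I)=\{FT(F,I):F\in\mathcal H\}^\land$, likewise for $\lor$; $FT(F\to F',I)=\bot$ if $I\not\models F\to F'$, else $FT(F,I)\to FT(F',I)$. Extended literals: $p,\neg p,\neg\neg p$. A simple disjunction is a disjunction of extended literals; a simple implication is $\mathcal A^\land\to\mathcal L^\lor$ with $\mathcal A$ a set of atoms and $\mathcal L^\lor$ a simple disjunction; a simple formula is a conjunction of simple implications. For a set $X$ of atoms, the operation $(\cdot)^X_\bot$: for a disjunction $F$, remove all disjunctive terms that are atoms in $X$; for an implication $F_1\to F_2$ with $F_1$ a conjunction, leave it unchanged if some conjunctive term of $F_1$ is an atom in $X$, and otherwise replace it by $F_1\to(F_2)^X_\bot$; for a conjunction of such implications (or $\bot$), apply to each conjunctive term. This operation is applied to $FT(G,I)$. -}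

module Defs where

open import Data.Empty using (⊥)
open import Data.Product using (Σ; _×_; _,_)
open import Relation.Nullary using (¬_; Dec; yes; no)
open import Function using (_∘_)

-- Classical excluded middle, taken as an explicit hypothesis (needed to define
-- the FT-reduct, which branches on whether I satisfies an implication).
LEM : Set₁
LEM = (P : Set) → Dec P

module _ {Atom : Set} where

  -- Infinitary formulas; a set H of formulas is represented by an indexed
  -- family (K → Formula) with an arbitrary index type K.
  data Formula : Set₁ where
    atom : Atom → Formula
    conj : {K : Set} → (K → Formula) → Formula
    disj : {K : Set} → (K → Formula) → Formula
    _⇒_  : Formula → Formula → Formula

  ⊤f : Formula
  ⊤f = conj {⊥} (λ ())

  ⊥f : Formula
  ⊥f = disj {⊥} (λ ())

  ¬f : Formula → Formula
  ¬f F = F ⇒ ⊥f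

  Interp : Set₁
  Interp = Atom → Set

  _⊨_ : Interp → Formula → Set
  I ⊨ atom p = I p
  I ⊨ conj {K} f = (k : K) → I ⊨ f k
  I ⊨ disj {K} f = Σ K (λ k → I ⊨ f k)
  I ⊨ (F ⇒ G) = I ⊨ F → I ⊨ G

  _∖_ : Interp → Interp → Interp
  (I ∖ J) a = I a × ¬ J a

  FT : LEM → Formula → Interp → Formula
  FT lem (atom p) I with lem (I p)
  ... | yes _ = atom p
  ... | no _ = ⊥f
  FT lem (conj f) I = conj (λ k → FT lem (f k) I)
  FT lem (disj f) I = disj (λ k → FT lem (f k) I)
  FT lem (F ⇒ G) I with lem (I ⊨ (F ⇒ G))
  ... | yes _ = FT lem F I ⇒ FT lem G I
  ... | no _ = ⊥f

  data ExtLit : Formula → Set₁ where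
    pos  : (p : Atom) → ExtLit (atom p)
    neg  : (p : Atom) → ExtLit (¬f (atom p))
    neg2 : (p : Atom) → ExtLit (¬f (¬f (atom p)))

  data SimpleDisj : Formula → Set₁ where
    sdisj : {L : Set} (h : L → Formula) → ((l : L) → ExtLit (h l)) → SimpleDisj (disj h)

  data SimpleImp : Formula → Set₁ where
    simp : {K : Set} (g : K → Atom) (D : Formula) → SimpleDisj D →
           SimpleImp (conj (atom ∘ g) ⇒ D)

  data SimpleFormula : Formula → Set₁ where
    simple : {K : Set} (f : K → Formula) → ((k : K) → SimpleImp (f k)) →
             SimpleFormula (conj f)

  AtomIn : Interp → Formula → Set
  AtomIn X (atom p) = X p
  AtomIn X _ = ⊥

  -- (·)^X_⊥ on a disjunction: remove the disjunctive terms that are atoms in X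
  redDisj : Interp → Formula → Formula
  redDisj X (disj {K} f) = disj {Σ K (λ k → ¬ AtomIn X (f k))} (λ { (k , _) → f k })
  redDisj X F = F

  redImp : LEM → Interp → Formula → Formula
  redImp lem X (conj {K} g ⇒ F₂) with lem (Σ K (λ k → AtomIn X (g k)))
  ... | yes _ = conj g ⇒ F₂
  ... | no _ = conj g ⇒ redDisj X F₂
  redImp lem X F = F

  -- (·)^X_⊥ on a conjunction of such implications (or ⊥, left as is)
  red : LEM → Interp → Formula → Formula
  red lem X (conj f) = conj (λ k → redImp lem X (f k))
  red lem X F = F

{-# OPTIONS --safe #-}
module Submission where

-- Write X = I ∖ J.  A simple implication whose FT-reduct keeps an atom of X in
-- its body is satisfied by J vacuously, since J misses that atom.  Otherwise J
-- satisfying the body forces I to satisfy it, so I picks a disjunct that is not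
-- an atom of X.  A positive literal p of this kind lies in I but not in X, hence
-- in J.  A negative literal ¬F with I ⊨ ¬F has a reduct FT(F, I) → ⊥ that no
-- interpretation can violate, because satisfying FT(F, I) means I ⊨ F whenever
-- F is an atom or an implication.

open import Defs
open import Data.Empty using (⊥-elim)
open import Data.Product using (Σ; _,_; proj₁)
open import Relation.Nullary using (¬_; yes; no)
open import Function using (_∘_)

module _ {Atom : Set} (lem : LEM) where

  atomIn-∖⇒¬⊨ : {I J : Interp {Atom}} (F : Formula) → AtomIn (I ∖ J) F → ¬ (J ⊨ F)
  atomIn-∖⇒¬⊨ (atom p) (_ , ¬Jp) Jp = ¬Jp Jp

  ⊨FT-atom⇒⊨ : {I J : Interp {Atom}} (p : Atom) → J ⊨ FT lem (atom p) I → I ⊨ atom p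
  ⊨FT-atom⇒⊨ {I} p J⊨ with lem (I p)
  ... | yes Ip = Ip
  ... | no _   = ⊥-elim (proj₁ J⊨)

  ⊨⇒⊨FT-atom : {I J : Interp {Atom}} (p : Atom) → I p → J p → J ⊨ FT lem (atom p) I
  ⊨⇒⊨FT-atom {I} p Ip Jp with lem (I p)
  ... | yes _  = Jp
  ... | no ¬Ip = ⊥-elim (¬Ip Ip)

  ⊨FT-⇒⇒⊨ : {I J : Interp {Atom}} (F G : Formula) → J ⊨ FT lem (F ⇒ G) I → I ⊨ (F ⇒ G)
  ⊨FT-⇒⇒⊨ {I} F G J⊨ with lem (I ⊨ (F ⇒ G))
  ... | yes I⊨ = I⊨
  ... | no _   = ⊥-elim (proj₁ J⊨)

  ⊨FT-¬ : {I J : Interp {Atom}} (F : Formula) →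
          (∀ {J′} → J′ ⊨ FT lem F I → I ⊨ F) →
          I ⊨ ¬f F → J ⊨ FT lem (¬f F) I
  ⊨FT-¬ {I} F sound I⊨¬F with lem (I ⊨ ¬f F)
  ... | yes _   = λ J⊨F → ⊥-elim (proj₁ (I⊨¬F (sound J⊨F)))
  ... | no I⊭¬F = ⊥-elim (I⊭¬F I⊨¬F)

  extLit-persists : {I J : Interp {Atom}} {F : Formula} → ExtLit F →
                    I ⊨ FT lem F I → ¬ AtomIn (I ∖ J) (FT lem F I) → J ⊨ FT lem F I
  extLit-persists {I} {J} (pos p) I⊨ ∉X with lem (I p)
  ... | no _ = ⊥-elim (proj₁ I⊨)
  ... | yes Ip with lem (J p)
  ...   | yes Jp = Jp
  ...   | no ¬Jp = ⊥-elim (∉X (Ip , ¬Jp))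
  extLit-persists (neg p) I⊨ _ =
    ⊨FT-¬ (atom p) (⊨FT-atom⇒⊨ p) (⊨FT-⇒⇒⊨ (atom p) ⊥f I⊨)
  extLit-persists (neg2 p) I⊨ _ =
    ⊨FT-¬ (¬f (atom p)) (⊨FT-⇒⇒⊨ (atom p) ⊥f) (⊨FT-⇒⇒⊨ (¬f (atom p)) ⊥f I⊨)

  simpleImp-persists : {I J : Interp {Atom}} {F : Formula} → SimpleImp F →
                       I ⊨ redImp lem (I ∖ J) (FT lem F I) → J ⊨ FT lem F I
  simpleImp-persists {I} {J} (simp {K} g _ (sdisj h isLit)) hyp
    with lem (I ⊨ (conj (atom ∘ g) ⇒ disj h))
  ... | no _ = ⊥-elim (proj₁ hyp)
  ... | yes _ with lem (Σ K (λ k → AtomIn (I ∖ J) (FT lem (atom (g k)) I)))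
  ...   | yes (k , inX) = λ J⊨body → ⊥-elim (atomIn-∖⇒¬⊨ (FT lem (atom (g k)) I) inX (J⊨body k))
  ...   | no _ = λ J⊨body →
    let ((l , ∉X) , I⊨l) = hyp (λ k → let Igk = ⊨FT-atom⇒⊨ (g k) (J⊨body k)
                                      in ⊨⇒⊨FT-atom (g k) Igk Igk)
    in l , extLit-persists (isLit l) I⊨l ∉X

lemma7 : (lem : LEM) {Atom : Set} (G : Formula {Atom}) (I J : Interp {Atom}) →
    SimpleFormula G →
    I ⊨ red lem (I ∖ J) (FT lem G I) →
    J ⊨ FT lem G I
lemma7 lem _ I J (simple f isImp) hyp k = simpleImp-persists lem (isImp k) (hyp k)
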